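{- Let $n\geq 4$ be an integer and set $a=f_n^2$, $b=f_{n+1}^2$, $c=f_{n+2}^2$. Let $s_0$ be the least non-negative integer such that $b s_0\equiv c \pmod{a}$, and let $T_0=\frac{1}{a}(b s_0-c)$. Then \[ s_0=\begin{cases} f_nf_{n-3}+1, & \text{if $n$ is even,} \\ 2f_nf_{n-2}+1, & \text{if $n$ is odd,}\end{cases} \qquad T_0=\begin{cases} f_nf_{n-1}-2, & \text{if $n$ is even,} \\ 2f_n^2-3, & \text{if $n$ is odd.} \end{cases} \]
   Context: The Fibonacci numbers are defined by $f_0=0$, $f_1=1$, $f_k=f_{k-1}+f_{k-2}$ for $k\geq 2$. -}

module Defs where

open import Data.Nat using (ℕ; zero; suc; _+_; _*_; _≤_)
open import Data.Integer as ℤ using (ℤ; +_)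
open import Data.Integer.Divisibility using (_∣_)
open import Data.Product using (_×_)

fib : ℕ → ℕ
fib zero = 0
fib (suc zero) = 1
fib (suc (suc k)) = fib (suc k) + fib k

_≡_[mod_] : ℤ → ℤ → ℕ → Set
x ≡ y [mod m ] = (+ m) ∣ (x ℤ.- y)

IsLeast : (ℕ → Set) → ℕ → Set
IsLeast P s = P s × (∀ t → P t → s ≤ t)

{-# OPTIONS --safe #-}
module Submission where

-- Cassini's identity f_{n-1} f_{n+1} = f_n² + (-1)^n
-- makes f_{n-1}² an inverse of b modulo a, so b s ≡ c (mod a) has exactly one solution in
-- [0, a), which is therefore the least one. It remains to check that the claimed s₀ lies
-- below a and that b s₀ - c = a T₀. In x = f_{n-3} and y = f_{n-2} the latter is a polynomial
-- identity modulo Cassini's relation x² + x y - y² = (-1)^n, which is where the parity enters.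

open import Defs
open import Data.Nat as ℕ using (ℕ; zero; suc; _≤_; _<_; _∸_; s≤s; z≤n; z<s)
import Data.Nat.Properties as ℕₚ
open import Data.Nat.Divisibility as ℕd using ()
open import Data.Integer as ℤ using (ℤ; +_)
import Data.Integer.Properties as ℤₚ
import Data.Integer.Divisibility.Signed as ℤd
open import Data.Product using (_×_; _,_)
open import Function using (_∘_)
open import Relation.Nullary using (¬_; contradiction)
open import Relation.Binary.PropositionalEquality
  using (_≡_; refl; sym; trans; cong; cong₂; subst; module ≡-Reasoning)

-- Integer arithmetic is opened only inside this module; outside it _+_ and _*_ are those of ℕ.
module _ where
  open import Data.Integer using (_+_; _*_; _-_; -_; _^_; 1ℤ; -1ℤ)
  open import Data.Integer.Tactic.RingSolver using (solve-∀)
  open ≡-Reasoning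

  unit-cancel : ∀ {a} {b v c x y : ℤ} → (b * v) ≡ 1ℤ [mod a ] →
                (b * x) ≡ c [mod a ] → (b * y) ≡ c [mod a ] → x ≡ y [mod a ]
  unit-cancel {a} {b} {v} {c} {x} {y} bv≡1 bx≡c by≡c =
    ℤd.∣⇒∣ᵤ (subst (+ a ℤd.∣_) (combination b v c x y)
      (ℤd.∣m∣n⇒∣m-n (ℤd.∣m∣n⇒∣m-n (ℤd.∣n⇒∣m*n v (ℤd.∣ᵤ⇒∣ bx≡c)) (ℤd.∣n⇒∣m*n v (ℤd.∣ᵤ⇒∣ by≡c)))
                    (ℤd.∣n⇒∣m*n (x - y) (ℤd.∣ᵤ⇒∣ bv≡1))))
    where
    combination : ∀ b v c x y → v * (b * x - c) - v * (b * y - c) - (x - y) * (b * v - 1ℤ) ≡ x - y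
    combination = solve-∀

  ∣-<⇒≡0 : ∀ {m n} → m ℕd.∣ n → n < m → n ≡ 0
  ∣-<⇒≡0 {n = zero}  _   _   = refl
  ∣-<⇒≡0 {n = suc _} m∣n n<m = contradiction m∣n (ℕd.>⇒∤ n<m)

  congruent-<⇒≡ : ∀ {a x y} → (+ x) ≡ (+ y) [mod a ] → x < a → y < a → x ≡ y
  congruent-<⇒≡ {a} {x} {y} a∣x-y x<a y<a =
    ℤₚ.+-injective (ℤₚ.i-j≡0⇒i≡j (+ x) (+ y) (ℤₚ.∣i∣≡0⇒i≡0 (∣-<⇒≡0 a∣x-y ∣x-y∣<a)))
    where
    ∣x-y∣<a : ℤ.∣ + x - + y ∣ < a
    ∣x-y∣<a = subst (_< a) (cong ℤ.∣_∣ (sym (ℤₚ.[+m]-[+n]≡m⊖n x y)))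
                (ℕₚ.≤-<-trans (ℤₚ.∣m⊝n∣≤m⊔n x y) (ℕₚ.⊔-lub x<a y<a))

  least-solution : ∀ {a s s₀ : ℕ} {b c v T T₀ : ℤ} →
    (b * v) ≡ 1ℤ [mod a ] → s < a → + a * T ≡ b * + s - c →
    IsLeast (λ t → (b * + t) ≡ c [mod a ]) s₀ → + a * T₀ ≡ b * + s₀ - c →
    s₀ ≡ s × T₀ ≡ T
  least-solution {a} {s} {s₀} {b} {c} {v} {T} {T₀} bv≡1 s<a aT≡bs-c (s₀-solves , s₀-least) aT₀≡bs₀-c =
    s₀≡s , ℤₚ.*-cancelˡ-≡ (+ a) T₀ T {{ℕ.>-nonZero (ℕₚ.≤-<-trans z≤n s<a)}}
             (trans aT₀≡bs₀-c (trans (cong (λ t → b * + t - c) s₀≡s) (sym aT≡bs-c)))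
    where
    s-solves : (b * + s) ≡ c [mod a ]
    s-solves = ℤd.∣⇒∣ᵤ (ℤd.divides T (trans (sym aT≡bs-c) (ℤₚ.*-comm (+ a) T)))
    s₀≡s : s₀ ≡ s
    s₀≡s = congruent-<⇒≡ (unit-cancel {b = b} {v} {c} bv≡1 s₀-solves s-solves)
             (ℕₚ.≤-<-trans (s₀-least s s-solves) s<a) s<a

  -1^even≡1 : ∀ n → 2 ℕd.∣ n → -1ℤ ^ n ≡ 1ℤ
  -1^even≡1 zero          _     = refl
  -1^even≡1 (suc zero)    2∣1   = contradiction (ℕd.∣1⇒≡1 2∣1) λ ()
  -1^even≡1 (suc (suc n)) 2∣2+n rewrite -1^even≡1 n (ℕd.∣m+n∣m⇒∣n 2∣2+n ℕd.∣-refl) = refl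

  -1^odd≡-1 : ∀ n → ¬ 2 ℕd.∣ n → -1ℤ ^ n ≡ -1ℤ
  -1^odd≡-1 zero          2∤0   = contradiction (2 ℕd.∣0) 2∤0
  -1^odd≡-1 (suc zero)    _     = refl
  -1^odd≡-1 (suc (suc n)) 2∤2+n rewrite -1^odd≡-1 n (2∤2+n ∘ ℕd.∣m∣n⇒∣m+n ℕd.∣-refl) = refl

  -1^n*-1^n≡1 : ∀ n → -1ℤ ^ n * -1ℤ ^ n ≡ 1ℤ
  -1^n*-1^n≡1 zero    = refl
  -1^n*-1^n≡1 (suc n) = trans (negations-cancel (-1ℤ ^ n)) (-1^n*-1^n≡1 n)
    where
    negations-cancel : ∀ e → - 1ℤ * e * (- 1ℤ * e) ≡ e * e
    negations-cancel = solve-∀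

  cassini : ∀ n → + fib (suc n) * + fib (suc n) - + fib n * + fib (suc (suc n)) ≡ -1ℤ ^ n
  cassini zero    = refl
  cassini (suc n) = begin
    (y + x) * (y + x) - y * (y + x + y) ≡⟨ step x y ⟩
    - (y * y - x * (y + x))             ≡⟨ cong -_ (cassini n) ⟩
    - -1ℤ ^ n                           ≡⟨ sym (ℤₚ.-1*i≡-i (-1ℤ ^ n)) ⟩
    -1ℤ ^ suc n                         ∎
    where
    x y : ℤ
    x = + fib n
    y = + fib (suc n)
    step : ∀ x y → (y + x) * (y + x) - y * (y + x + y) ≡ - (y * y - x * (y + x))
    step = solve-∀

  ≡-modulo-relation : ∀ {u v l r : ℤ} m → l ≡ r → u ≡ v + m * (l - r) → u ≡ v
  ≡-modulo-relation {v = v} {l} m refl u≡v+m[l-l] = trans u≡v+m[l-l] (vanish v m l)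
    where
    vanish : ∀ v m l → v + m * (l - l) ≡ v
    vanish = solve-∀

  fib²-unit : ∀ n → (+ (fib (suc (suc n)) ℕ.* fib (suc (suc n))) * + (fib n ℕ.* fib n))
                       ≡ 1ℤ [mod fib (suc n) ℕ.* fib (suc n) ]
  fib²-unit n = ℤd.∣⇒∣ᵤ (ℤd.divides (x * z - e) (begin
    + (fib (suc (suc n)) ℕ.* fib (suc (suc n))) * + (fib n ℕ.* fib n) - 1ℤ
      ≡⟨ cong₂ (λ s t → s * t - 1ℤ) (ℤₚ.pos-* (fib (suc (suc n))) _) (ℤₚ.pos-* (fib n) _) ⟩
    z * z * (x * x) - 1ℤ
      ≡⟨ cong (λ t → z * z * (x * x) - t) (sym (-1^n*-1^n≡1 n)) ⟩
    z * z * (x * x) - e * e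
      ≡⟨ ≡-modulo-relation (e - x * z) (cassini n) (factorisation x y z e) ⟩
    (x * z - e) * (y * y)
      ≡⟨ cong ((x * z - e) *_) (sym (ℤₚ.pos-* (fib (suc n)) _)) ⟩
    (x * z - e) * + (fib (suc n) ℕ.* fib (suc n)) ∎))
    where
    x y z e : ℤ
    x = + fib n
    y = + fib (suc n)
    z = + fib (suc (suc n))
    e = -1ℤ ^ n
    factorisation : ∀ x y z e →
      z * z * (x * x) - e * e ≡ (x * z - e) * (y * y) + (e - x * z) * (y * y - x * z - e)
    factorisation = solve-∀

  -- n = k + 3, and Cassini's identity at k + 1 = n - 2 is the relation p * p - y * f ≡ ±1.
  module _ (k : ℕ) where
    private
      n : ℕ
      n = suc (suc (suc k))
      x y p f g h : ℤ
      x = + fib k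
      y = + fib (suc k)
      p = y + x
      f = p + y
      g = f + p
      h = g + f

    even-solution : -1ℤ ^ suc k ≡ 1ℤ →
      + (fib n ℕ.* fib n) * (+ (fib n ℕ.* fib (n ∸ 1)) - + 2)
        ≡ + (fib (suc n) ℕ.* fib (suc n)) * + (fib n ℕ.* fib (n ∸ 3) ℕ.+ 1)
          - + (fib (suc (suc n)) ℕ.* fib (suc (suc n)))
    even-solution ε≡1 = begin
      + (fib n ℕ.* fib n) * (+ (fib n ℕ.* fib (n ∸ 1)) - + 2)
        ≡⟨ cong₂ (λ a t → a * (t - + 2)) (ℤₚ.pos-* (fib n) _) (ℤₚ.pos-* (fib n) _) ⟩
      f * f * (f * p - + 2)
        ≡⟨ ≡-modulo-relation (- ((+ 3 * x + + 4 * y) * f)) (trans (cassini (suc k)) ε≡1) (identity x y) ⟩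
      g * g * (f * x + 1ℤ) - h * h
        ≡⟨ sym (cong₂ _-_ (cong₂ (λ b t → b * (t + 1ℤ)) (ℤₚ.pos-* (fib (suc n)) _) (ℤₚ.pos-* (fib n) _))
                          (ℤₚ.pos-* (fib (suc (suc n))) _)) ⟩
      + (fib (suc n) ℕ.* fib (suc n)) * + (fib n ℕ.* fib (n ∸ 3) ℕ.+ 1)
        - + (fib (suc (suc n)) ℕ.* fib (suc (suc n)))                     ∎
      where
      identity : ∀ x y → let p = y + x ; f = p + y ; g = f + p ; h = g + f in
        f * f * (f * p - + 2)
          ≡ g * g * (f * x + 1ℤ) - h * h + - ((+ 3 * x + + 4 * y) * f) * (p * p - y * f - 1ℤ)
      identity = solve-∀

    odd-solution : -1ℤ ^ suc k ≡ -1ℤ →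
      + (fib n ℕ.* fib n) * (+ (2 ℕ.* fib n ℕ.* fib n) - + 3)
        ≡ + (fib (suc n) ℕ.* fib (suc n)) * + (2 ℕ.* fib n ℕ.* fib (n ∸ 2) ℕ.+ 1)
          - + (fib (suc (suc n)) ℕ.* fib (suc (suc n)))
    odd-solution ε≡-1 = begin
      + (fib n ℕ.* fib n) * (+ (2 ℕ.* fib n ℕ.* fib n) - + 3)
        ≡⟨ cong₂ (λ a t → a * (t - + 3)) (ℤₚ.pos-* (fib n) _) (pos-2** (fib n) _) ⟩
      f * f * (+ 2 * f * f - + 3)
        ≡⟨ ≡-modulo-relation (+ 2 * p * f) (trans (cassini (suc k)) ε≡-1) (identity x y) ⟩
      g * g * (+ 2 * f * y + 1ℤ) - h * h
        ≡⟨ sym (cong₂ _-_ (cong₂ (λ b t → b * (t + 1ℤ)) (ℤₚ.pos-* (fib (suc n)) _) (pos-2** (fib n) _))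
                          (ℤₚ.pos-* (fib (suc (suc n))) _)) ⟩
      + (fib (suc n) ℕ.* fib (suc n)) * + (2 ℕ.* fib n ℕ.* fib (n ∸ 2) ℕ.+ 1)
        - + (fib (suc (suc n)) ℕ.* fib (suc (suc n)))                     ∎
      where
      pos-2** : ∀ a b → + (2 ℕ.* a ℕ.* b) ≡ + 2 * + a * + b
      pos-2** a b = trans (ℤₚ.pos-* (2 ℕ.* a) b) (cong (_* + b) (ℤₚ.pos-* 2 a))
      identity : ∀ x y → let p = y + x ; f = p + y ; g = f + p ; h = g + f in
        f * f * (+ 2 * f * f - + 3)
          ≡ g * g * (+ 2 * f * y + 1ℤ) - h * h + + 2 * p * f * (p * p - y * f - - 1ℤ)
      identity = solve-∀

open import Data.Nat using (_+_; _*_)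
open import Data.Nat.Tactic.RingSolver using (solve-∀)

m*n+1<m*m : ∀ {m n} → 1 < m → n < m → m * n + 1 < m * m
m*n+1<m*m {m} {n} 1<m n<m = begin-strict
  m * n + 1 <⟨ ℕₚ.+-monoʳ-< (m * n) 1<m ⟩
  m * n + m ≡⟨ ℕₚ.+-comm (m * n) m ⟩
  m + m * n ≡⟨ ℕₚ.*-suc m n ⟨
  m * suc n ≤⟨ ℕₚ.*-monoʳ-≤ m n<m ⟩
  m * m     ∎
  where open ℕₚ.≤-Reasoning

fib-pos : ∀ {n} → 0 < n → 0 < fib n
fib-pos {suc zero}    _ = z<s
fib-pos {suc (suc n)} _ = ℕₚ.≤-trans (fib-pos {suc n} z<s) (ℕₚ.m≤m+n _ (fib n))

1<fib[3+k] : ∀ k → 1 < fib (3 + k)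
1<fib[3+k] k = ℕₚ.+-mono-≤ (ℕₚ.≤-trans 0<y (ℕₚ.m≤m+n _ (fib k))) 0<y
  where
  0<y : 0 < fib (1 + k)
  0<y = fib-pos {1 + k} z<s

even-bound : ∀ k → fib (3 + k) * fib k + 1 < fib (3 + k) * fib (3 + k)
even-bound k = m*n+1<m*m (1<fib[3+k] k)
  (ℕₚ.<-≤-trans (ℕₚ.m<n+m (fib k) (fib-pos {1 + k} z<s)) (ℕₚ.m≤m+n _ (fib (1 + k))))

odd-bound : ∀ {k} → 0 < k → 2 * fib (3 + k) * fib (1 + k) + 1 < fib (3 + k) * fib (3 + k)
odd-bound {k} 0<k =
  subst (λ t → t + 1 < fib (3 + k) * fib (3 + k)) (sym (regroup (fib (3 + k)) (fib (1 + k))))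
    (m*n+1<m*m (1<fib[3+k] k) (ℕₚ.+-monoˡ-< (fib (1 + k)) (ℕₚ.m<m+n (fib (1 + k)) (fib-pos 0<k))))
  where
  regroup : ∀ f y → 2 * f * y ≡ f * (y + y)
  regroup = solve-∀

lemma3p4 : (n : ℕ) → 4 ≤ n →
    (s₀ : ℕ) → IsLeast (λ s → ((+ (fib (n + 1) * fib (n + 1))) ℤ.* (+ s)) ≡ (+ (fib (n + 2) * fib (n + 2))) [mod (fib n * fib n) ]) s₀ →
    (T₀ : ℤ) → (+ (fib n * fib n)) ℤ.* T₀ ≡ (+ (fib (n + 1) * fib (n + 1))) ℤ.* (+ s₀) ℤ.- (+ (fib (n + 2) * fib (n + 2))) →
    (2 ℕd.∣ n → (s₀ ≡ fib n * fib (n ∸ 3) + 1) × ( T₀ ≡ + (fib n * fib (n ∸ 1)) ℤ.- + 2))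
    × (¬ 2 ℕd.∣ n → (s₀ ≡ 2 * fib n * fib (n ∸ 2) + 1) × ( T₀ ≡ + (2 * fib n * fib n) ℤ.- + 3))
lemma3p4 (suc (suc (suc k))) (s≤s (s≤s (s≤s 0<k))) s₀ least T₀ eqT
  -- n + 1 has normalised to 3 + (k + 1)
  rewrite ℕₚ.+-comm k 1 | ℕₚ.+-comm k 2 =
    (λ 2∣n → least-solution {b = b} (fib²-unit (2 + k)) (even-bound k)
               (even-solution k (-1^even≡1 (1 + k) (ℕd.∣m+n∣m⇒∣n 2∣n ℕd.∣-refl))) least eqT)
  , (λ 2∤n → least-solution {b = b} (fib²-unit (2 + k)) (odd-bound 0<k)
               (odd-solution k (-1^odd≡-1 (1 + k) (2∤n ∘ ℕd.∣m∣n⇒∣m+n ℕd.∣-refl))) least eqT)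
  where
  b : ℤ
  b = + (fib (4 + k) * fib (4 + k))
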